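{- Let $n\geqslant 1$ and $k_1,\dots,k_n$ be positive integers, and let $H=P_{k_1}\square\dots\square P_{k_n}$, where $P_{k}$ denotes the path with $k$ vertices. There exists an orientation of the edges of $H$ in which the outdegree of every vertex lies in $\{n-1,n\}$ if and only if \[ \frac{1}{k_1}+\dots+\frac{1}{k_n}\leqslant 1. \]
   Context: The Cartesian product $G_1\square G_2$ has vertex set $V(G_1)\times V(G_2)$, with $(v_1,v_2)$ and $(u_1,u_2)$ adjacent iff either $v_1=u_1$ and $v_2u_2\in E(G_2)$, or $v_2=u_2$ and $v_1u_1\in E(G_1)$. Thus the vertices of $H$ are tuples $(p_1,\dots,p_n)$ with $1\leqslant p_j\leqslant k_j$, two being adjacent iff they differ in exactly one coordinate and by exactly $1$ there. An orientation assigns a direction to each edge; the outdegree of a vertex is the number of edges directed away from it. -}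

module Defs where

open import Data.Nat using (ℕ; zero; suc; _≤_; _∸_)
open import Data.Fin using (Fin; toℕ)
open import Data.Bool using (Bool; true; false; _∧_; _∨_; T; not)
open import Data.Unit using (⊤; tt)
open import Data.Product using (Σ; _×_; _,_)
open import Data.Vec using (Vec; []; _∷_)
open import Data.Rational using (ℚ; 0ℚ; 1ℚ; _+_; _/_)
import Data.Integer as ℤ
import Data.Rational as ℚ
open import Data.Nat using (_≡ᵇ_)
open import Function.Bundles using (_↔_)
open import Data.Sum using (_⊎_)
open import Data.Empty using (⊥)
open import Data.Vec.Relation.Unary.All using (All; []; _∷_)
open import Data.Nat.Base using (>-nonZero)

Vertex : {n : ℕ} → Vec ℕ n → Set
Vertex []       = ⊤
Vertex (k ∷ ks) = Fin k × Vertex ks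

diff1 : ℕ → ℕ → Bool
diff1 a b = ((suc a) ≡ᵇ b) ∨ ((suc b) ≡ᵇ a)

eqV : {n : ℕ} (ks : Vec ℕ n) → Vertex ks → Vertex ks → Bool
eqV []       _        _        = true
eqV (k ∷ ks) (p , v) (q , u) = (toℕ p ≡ᵇ toℕ q) ∧ eqV ks v u

adjB : {n : ℕ} (ks : Vec ℕ n) → Vertex ks → Vertex ks → Bool
adjB []       _        _        = false
adjB (k ∷ ks) (p , v) (q , u) =
  (diff1 (toℕ p) (toℕ q) ∧ eqV ks v u) ∨ ((toℕ p ≡ᵇ toℕ q) ∧ adjB ks v u)

Adj : {n : ℕ} (ks : Vec ℕ n) → Vertex ks → Vertex ks → Set
Adj ks v u = T (adjB ks v u)

record Orientation {n : ℕ} (ks : Vec ℕ n) : Set where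
  field
    arc      : Vertex ks → Vertex ks → Bool
    arc⇒adj  : ∀ v u → T (arc v u) → Adj ks v u
    oriented : ∀ v u → Adj ks v u → T (arc v u) ⊎ T (arc u v)
    antisym  : ∀ v u → T (arc v u) → T (arc u v) → ⊥

OutdegreeIs : {n : ℕ} {ks : Vec ℕ n} → Orientation ks → Vertex ks → ℕ → Set
OutdegreeIs {ks = ks} o v d =
  Fin d ↔ Σ (Vertex ks) (λ u → T (Orientation.arc o v u))

invSum : {n : ℕ} (ks : Vec ℕ n) → All (λ k → 1 ≤ k) ks → ℚ
invSum []       []         = 0ℚ
invSum (k ∷ ks) (k≥1 ∷ ps) = ((ℤ.+ 1) / k) {{>-nonZero k≥1}} + invSum ks ps

module Submission where

-- Write P = k₁⋯kₙ for the number of vertices and W = Σᵢ Πⱼ≠ᵢ kⱼ, so that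
-- Σ 1/kᵢ = W / P and the condition reads W ≤ P (invSum≤1⇔W≤P).
--
-- Necessity is double counting: H has n P - W edges (degree-sum), and the
-- outdegrees of any orientation add up to the number of edges (outdeg-sum),
-- so outdegrees of at least n - 1 give P (n - 1) ≤ n P - W.
--
-- Orienting every line of H (a copy of some
-- P_{kᵢ}) towards a chosen sink gives each vertex outdegree n minus the number
-- of directions in which it is a sink (outdeg-towards). The sinks are chosen
-- by the hash h(v) = Σ pᵢ P/kᵢ modulo P: along a line of direction i the hash
-- runs through a full residue class modulo P/kᵢ, so one of its vertices
-- has its hash in a window of length P/kᵢ reserved for direction i. W ≤ P
-- lets these n windows be disjoint, so every vertex is a sink in at most one
-- direction (sinks-hashRule).

open import Defs
open import Data.Nat using (ℕ; zero; suc; _+_; _*_; _∸_; _≤_; _<_; _≡ᵇ_; _<ᵇ_; z≤n; s≤s;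
  NonZero; >-nonZero; >-nonZero⁻¹; _/_; _%_)
open import Data.Nat.Properties
open import Data.Nat.DivMod
open import Data.Nat.Divisibility using (n∣m*n)
open import Data.Nat.Solver using (module +-*-Solver)
open +-*-Solver using (solve; _:+_; _:*_; _:=_; con)
open import Algebra.Properties.Semiring.Sum +-*-semiring
  using (sum-syntax; sum-cong-≗; ∑-distrib-+; ∑-comm; *-distribˡ-sum; *-distribʳ-sum)
open import Algebra.Properties.CommutativeSemigroup +-commutativeSemigroup
  using (interchange; xy∙z≈xz∙y)
open import Data.Fin using (Fin; toℕ) renaming (zero to fz; suc to fs)
open import Data.Fin.Properties using (+↔⊎; toℕ-injective; toℕ<n; toℕ-fromℕ<)
open import Data.Fin.Permutation using (↔⇒≡)
open import Data.Bool using (Bool; true; false; _∧_; _∨_; T)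
open import Data.Bool.Properties using (T-∧; T-∨)
open import Data.Unit using (⊤; tt)
open import Data.Empty using (⊥; ⊥-elim)
open import Data.Product using (Σ; _×_; _,_; proj₁; proj₂; uncurry)
open import Data.Product.Properties using (,-injective)
open import Data.Product.Algebra using (Σ-assoc)
open import Data.Product.Function.NonDependent.Propositional using (_×-⇔_)
import Data.Product.Function.Dependent.Propositional as Σ
open import Data.Sum using (_⊎_; inj₁; inj₂; swap)
import Data.Sum
open import Data.Sum.Function.Propositional using (_⊎-↔_; _⊎-⇔_)
open import Data.Vec using (Vec; []; _∷_)
open import Data.Vec.Relation.Unary.All using (All; []; _∷_)
import Data.Integer as ℤ
import Data.Integer.Properties as ℤP
import Data.Rational as ℚ
open import Data.Rational using (1ℚ)
open import Data.Rational.Properties using (toℚᵘ-homo-+; toℚᵘ-fromℚᵘ; toℚᵘ-mono-≤; toℚᵘ-cancel-≤)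
import Data.Rational.Unnormalised as ℚᵘ
open import Data.Rational.Unnormalised using (mkℚᵘ; *≡*; *≤*)
import Data.Rational.Unnormalised.Properties as ℚᵘP
open import Function using (_∘_)
open import Function.Bundles using (_↔_; _⇔_; Equivalence; mk↔ₛ′; mk⇔)
open import Function.Properties.Inverse using (↔-refl; ↔-sym; ↔-trans)
open import Function.Construct.Composition using (_⇔-∘_)
open import Function.Construct.Identity using (⇔-id)
open import Relation.Binary.PropositionalEquality
open import Relation.Nullary using (yes; no)

ind : Bool → ℕ
ind true  = 1
ind false = 0

∑-mono : ∀ k {f g : Fin k → ℕ} → (∀ q → f q ≤ g q) → ∑[ q < k ] f q ≤ ∑[ q < k ] g q
∑-mono zero    f≤g = z≤n
∑-mono (suc k) f≤g = +-mono-≤ (f≤g fz) (∑-mono k (λ q → f≤g (fs q)))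

∑-const : ∀ k c → ∑[ q < k ] c ≡ k * c
∑-const zero    c = refl
∑-const (suc k) c = cong (c +_) (∑-const k c)

∑-point : ∀ k a → a < k → ∑[ q < k ] ind (a ≡ᵇ toℕ q) ≡ 1
∑-point (suc k) zero    _         = cong suc (trans (∑-const k 0) (*-zeroʳ k))
∑-point (suc k) (suc a) (s≤s a<k) = ∑-point k a a<k

∑-point-* : ∀ k a c → a < k → ∑[ q < k ] (ind (a ≡ᵇ toℕ q) * c) ≡ c
∑-point-* k a c a<k = begin
  ∑[ q < k ] (ind (a ≡ᵇ toℕ q) * c) ≡⟨ *-distribʳ-sum {k} c (λ q → ind (a ≡ᵇ toℕ q)) ⟨
  ∑[ q < k ] ind (a ≡ᵇ toℕ q) * c   ≡⟨ cong (_* c) (∑-point k a a<k) ⟩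
  1 * c                             ≡⟨ *-identityˡ c ⟩
  c                                 ∎
  where open ≡-Reasoning

∑-point-if : ∀ k a c → (T c → a < k) → ∑[ q < k ] ind (c ∧ (a ≡ᵇ toℕ q)) ≡ ind c
∑-point-if k a false _   = trans (∑-const k 0) (*-zeroʳ k)
∑-point-if k a true  a<k = ∑-point k a (a<k tt)

P : ∀ {n} → Vec ℕ n → ℕ
P []       = 1
P (k ∷ ks) = k * P ks

Σᵛ : ∀ {n} (ks : Vec ℕ n) → (Vertex ks → ℕ) → ℕ
Σᵛ []       g = g tt
Σᵛ (k ∷ ks) g = ∑[ p < k ] Σᵛ ks (λ v → g (p , v))

Σᵛ-cong : ∀ {n} (ks : Vec ℕ n) {f g : Vertex ks → ℕ} → (∀ v → f v ≡ g v) → Σᵛ ks f ≡ Σᵛ ks g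
Σᵛ-cong []       f≡g = f≡g tt
Σᵛ-cong (k ∷ ks) f≡g = sum-cong-≗ {k} (λ p → Σᵛ-cong ks (λ v → f≡g (p , v)))

Σᵛ-distrib-+ : ∀ {n} (ks : Vec ℕ n) (f g : Vertex ks → ℕ) →
  Σᵛ ks (λ v → f v + g v) ≡ Σᵛ ks f + Σᵛ ks g
Σᵛ-distrib-+ []       f g = refl
Σᵛ-distrib-+ (k ∷ ks) f g =
  trans (sum-cong-≗ {k} (λ p → Σᵛ-distrib-+ ks (λ v → f (p , v)) (λ v → g (p , v))))
        (∑-distrib-+ (λ p → Σᵛ ks (λ v → f (p , v))) (λ p → Σᵛ ks (λ v → g (p , v))))

*-distribˡ-Σᵛ : ∀ {n} (ks : Vec ℕ n) c (f : Vertex ks → ℕ) → c * Σᵛ ks f ≡ Σᵛ ks (λ v → c * f v)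
*-distribˡ-Σᵛ []       c f = refl
*-distribˡ-Σᵛ (k ∷ ks) c f =
  trans (*-distribˡ-sum c (λ p → Σᵛ ks (λ v → f (p , v))))
        (sum-cong-≗ {k} (λ p → *-distribˡ-Σᵛ ks c (λ v → f (p , v))))

Σᵛ-mono : ∀ {n} (ks : Vec ℕ n) {f g : Vertex ks → ℕ} → (∀ v → f v ≤ g v) → Σᵛ ks f ≤ Σᵛ ks g
Σᵛ-mono []       f≤g = f≤g tt
Σᵛ-mono (k ∷ ks) f≤g = ∑-mono k (λ p → Σᵛ-mono ks (λ v → f≤g (p , v)))

Σᵛ-const : ∀ {n} (ks : Vec ℕ n) c → Σᵛ ks (λ _ → c) ≡ P ks * c
Σᵛ-const []       c = sym (+-identityʳ c)
Σᵛ-const (k ∷ ks) c = begin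
  ∑[ p < k ] Σᵛ ks (λ _ → c) ≡⟨ sum-cong-≗ {k} (λ _ → Σᵛ-const ks c) ⟩
  ∑[ p < k ] (P ks * c)      ≡⟨ ∑-const k (P ks * c) ⟩
  k * (P ks * c)             ≡⟨ *-assoc k (P ks) c ⟨
  k * P ks * c               ∎
  where open ≡-Reasoning

Σᵛ-∑-comm : ∀ {n} (ks : Vec ℕ n) k (F : Vertex ks → Fin k → ℕ) →
  Σᵛ ks (λ v → ∑[ q < k ] F v q) ≡ ∑[ q < k ] Σᵛ ks (λ v → F v q)
Σᵛ-∑-comm []       k F = refl
Σᵛ-∑-comm (l ∷ ks) k F =
  trans (sum-cong-≗ {l} (λ p → Σᵛ-∑-comm ks k (λ v → F (p , v))))
        (∑-comm (λ p q → Σᵛ ks (λ v → F (p , v) q)))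

Σᵛ-comm : ∀ {n m} (ks : Vec ℕ n) (ls : Vec ℕ m) (F : Vertex ks → Vertex ls → ℕ) →
  Σᵛ ks (λ v → Σᵛ ls (F v)) ≡ Σᵛ ls (λ u → Σᵛ ks (λ v → F v u))
Σᵛ-comm []       ls F = refl
Σᵛ-comm (k ∷ ks) ls F =
  trans (sum-cong-≗ {k} (λ p → Σᵛ-comm ks ls (λ v → F (p , v))))
        (sym (Σᵛ-∑-comm ls k (λ u p → Σᵛ ks (λ v → F (p , v) u))))

ind-∧ : ∀ x y → ind (x ∧ y) ≡ ind x * ind y
ind-∧ true  y = sym (+-identityʳ (ind y))
ind-∧ false y = refl

ind-∨ : ∀ x y → (T x → T y → ⊥) → ind (x ∨ y) ≡ ind x + ind y
ind-∨ true  true  excl = ⊥-elim (excl tt tt)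
ind-∨ true  false excl = refl
ind-∨ false y     excl = refl

-- z holds exactly when one of the exclusive x, y does: the situation of an
-- edge {v, u} and its two possible directions.
ind-partition : ∀ {x y z : Bool} → (T x → T z) → (T y → T z) → (T z → T x ⊎ T y) →
  (T x → T y → ⊥) → ind x + ind y ≡ ind z
ind-partition {true}  {true}          _   _   _    excl = ⊥-elim (excl tt tt)
ind-partition {true}  {false} {true}  _   _   _    _    = refl
ind-partition {true}  {false} {false} x⇒z _   _    _    = ⊥-elim (x⇒z tt)
ind-partition {false} {true}  {true}  _   _   _    _    = refl
ind-partition {false} {true}  {false} _   y⇒z _    _    = ⊥-elim (y⇒z tt)
ind-partition {false} {false} {true}  _   _   z⇒xy _    with z⇒xy tt
... | inj₁ ()
... | inj₂ ()
ind-partition {false} {false} {false} _   _   _    _    = refl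

T-∧ˡ : ∀ {x y} → T (x ∧ y) → T x
T-∧ˡ = proj₁ ∘ Equivalence.to T-∧

count : ∀ {n} (ks : Vec ℕ n) → (Vertex ks → Bool) → ℕ
count ks f = Σᵛ ks (λ u → ind (f u))

T↔Fin-ind : ∀ b → T b ↔ Fin (ind b)
T↔Fin-ind true  = mk↔ₛ′ (λ _ → fz) (λ _ → tt) (λ { fz → refl ; (fs ()) }) (λ _ → refl)
T↔Fin-ind false = mk↔ₛ′ (λ ()) (λ ()) (λ ()) (λ ())

Σ-Fin-suc↔ : ∀ {k} (B : Fin (suc k) → Set) → Σ (Fin (suc k)) B ↔ (B fz ⊎ Σ (Fin k) (B ∘ fs))
Σ-Fin-suc↔ B = mk↔ₛ′ to from
  (λ { (inj₁ x) → refl ; (inj₂ (p , x)) → refl })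
  (λ { (fz , x) → refl ; (fs p , x) → refl })
  where
  to : Σ (Fin _) B → B fz ⊎ Σ (Fin _) (B ∘ fs)
  to (fz   , x) = inj₁ x
  to (fs p , x) = inj₂ (p , x)
  from : B fz ⊎ Σ (Fin _) (B ∘ fs) → Σ (Fin _) B
  from (inj₁ x)       = fz , x
  from (inj₂ (p , x)) = fs p , x

Σ-Fin↔ : ∀ k (c : Fin k → ℕ) → Σ (Fin k) (λ p → Fin (c p)) ↔ Fin (∑[ p < k ] c p)
Σ-Fin↔ zero    c = mk↔ₛ′ (λ { (() , _) }) (λ ()) (λ ()) (λ { (() , _) })
Σ-Fin↔ (suc k) c =
  ↔-trans (Σ-Fin-suc↔ (λ p → Fin (c p)))
    (↔-trans (↔-refl ⊎-↔ Σ-Fin↔ k (c ∘ fs)) (↔-sym +↔⊎))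

count↔ : ∀ {n} (ks : Vec ℕ n) (f : Vertex ks → Bool) →
  Σ (Vertex ks) (λ u → T (f u)) ↔ Fin (count ks f)
count↔ []       f = ↔-trans (mk↔ₛ′ proj₂ (tt ,_) (λ _ → refl) (λ _ → refl)) (T↔Fin-ind (f tt))
count↔ (k ∷ ks) f =
  ↔-trans Σ-assoc
    (↔-trans (Σ.congˡ (count↔ ks (λ v → f (_ , v))))
      (Σ-Fin↔ k (λ p → count ks (λ v → f (p , v)))))

outdeg : ∀ {n} {ks : Vec ℕ n} → Orientation ks → Vertex ks → ℕ
outdeg {ks = ks} o v = count ks (Orientation.arc o v)

outdegree-count : ∀ {n} {ks : Vec ℕ n} (o : Orientation ks) v d →
  OutdegreeIs o v d ⇔ (d ≡ count ks (Orientation.arc o v))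
outdegree-count {ks = ks} o v d = mk⇔
  (λ d↔ → ↔⇒≡ (↔-trans d↔ (count↔ ks (Orientation.arc o v))))
  (λ { refl → ↔-sym (count↔ ks (Orientation.arc o v)) })

outdeg-lower : ∀ {n} {ks : Vec ℕ n} (o : Orientation ks) v →
  OutdegreeIs o v (n ∸ 1) ⊎ OutdegreeIs o v n → n ∸ 1 ≤ outdeg o v
outdeg-lower {n} o v (inj₁ d) = ≤-reflexive (Equivalence.to (outdegree-count o v (n ∸ 1)) d)
outdeg-lower {n} o v (inj₂ d) = ≤-trans (m∸n≤m n 1) (≤-reflexive (Equivalence.to (outdegree-count o v n) d))

≡ᵇ-sym : ∀ a b → (a ≡ᵇ b) ≡ (b ≡ᵇ a)
≡ᵇ-sym zero    zero    = refl
≡ᵇ-sym zero    (suc b) = refl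
≡ᵇ-sym (suc a) zero    = refl
≡ᵇ-sym (suc a) (suc b) = ≡ᵇ-sym a b

≡ᵇ⇔≡ : ∀ {a b} → T (a ≡ᵇ b) ⇔ (a ≡ b)
≡ᵇ⇔≡ {a} {b} = mk⇔ (≡ᵇ⇒≡ a b) (≡⇒≡ᵇ a b)

<ᵇ⇔< : ∀ {a b} → T (a <ᵇ b) ⇔ (a < b)
<ᵇ⇔< {a} {b} = mk⇔ (<ᵇ⇒< a b) <⇒<ᵇ

toℕ-≡ᵇ⇔≡ : ∀ {k} {p q : Fin k} → T (toℕ p ≡ᵇ toℕ q) ⇔ (p ≡ q)
toℕ-≡ᵇ⇔≡ = mk⇔ (toℕ-injective ∘ Equivalence.to ≡ᵇ⇔≡) (Equivalence.from ≡ᵇ⇔≡ ∘ cong toℕ)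

eqV⇔≡ : ∀ {n} (ks : Vec ℕ n) {v u} → T (eqV ks v u) ⇔ (v ≡ u)
eqV⇔≡ []       = mk⇔ (λ _ → refl) (λ _ → tt)
eqV⇔≡ (k ∷ ks) = mk⇔ (uncurry (cong₂ _,_)) ,-injective ⇔-∘ ((toℕ-≡ᵇ⇔≡ ×-⇔ eqV⇔≡ ks) ⇔-∘ T-∧)

diff1⇔ : ∀ a b → T (diff1 a b) ⇔ (suc a ≡ b ⊎ suc b ≡ a)
diff1⇔ a b = (≡ᵇ⇔≡ {suc a} {b} ⊎-⇔ ≡ᵇ⇔≡ {suc b} {a}) ⇔-∘ T-∨

diff1-sym : ∀ a b → T (diff1 a b) → T (diff1 b a)
diff1-sym a b d = Equivalence.from (diff1⇔ b a) (swap (Equivalence.to (diff1⇔ a b) d))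

diff1-irrefl : ∀ a → T (diff1 a a) → ⊥
diff1-irrefl a d with Equivalence.to (diff1⇔ a a) d
... | inj₁ e = 1+n≢n e
... | inj₂ e = 1+n≢n e

diff1-excl : ∀ a b → T (suc a ≡ᵇ b) → T (suc b ≡ᵇ a) → ⊥
diff1-excl a b ab ba = <-asym (≤-reflexive (≡ᵇ⇒≡ (suc a) b ab)) (≤-reflexive (≡ᵇ⇒≡ (suc b) a ba))

-- Adjacency in H, and the arc relations built below, all have this shape:
-- a step x in the first coordinate with the rest fixed, or the first
-- coordinate fixed and a step y in the rest.
stepShape : ∀ {n k} (ks : Vec ℕ n) → Bool → (p q : Fin k) (v u : Vertex ks) → Bool → Bool
stepShape ks x p q v u y = (x ∧ eqV ks v u) ∨ ((toℕ p ≡ᵇ toℕ q) ∧ y)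

stepShape⇔ : ∀ {n k} (ks : Vec ℕ n) x (p q : Fin k) v u y →
  T (stepShape ks x p q v u y) ⇔ ((T x × v ≡ u) ⊎ (p ≡ q × T y))
stepShape⇔ ks x p q v u y =
  (((⇔-id _ ×-⇔ eqV⇔≡ ks) ⇔-∘ T-∧) ⊎-⇔ ((toℕ-≡ᵇ⇔≡ ×-⇔ ⇔-id _) ⇔-∘ T-∧)) ⇔-∘ T-∨

count-eqV : ∀ {n} (ks : Vec ℕ n) v → count ks (eqV ks v) ≡ 1
count-eqV []       v       = refl
count-eqV (k ∷ ks) (p , v) = begin
  ∑[ q < k ] Σᵛ ks (λ u → ind ((toℕ p ≡ᵇ toℕ q) ∧ eqV ks v u))
    ≡⟨ sum-cong-≗ {k} (λ q → Σᵛ-cong ks (λ u → ind-∧ (toℕ p ≡ᵇ toℕ q) (eqV ks v u))) ⟩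
  ∑[ q < k ] Σᵛ ks (λ u → ind (toℕ p ≡ᵇ toℕ q) * ind (eqV ks v u))
    ≡⟨ sum-cong-≗ {k} (λ q → *-distribˡ-Σᵛ ks (ind (toℕ p ≡ᵇ toℕ q)) (λ u → ind (eqV ks v u))) ⟨
  ∑[ q < k ] (ind (toℕ p ≡ᵇ toℕ q) * count ks (eqV ks v))
    ≡⟨ sum-cong-≗ {k} (λ q → cong (ind (toℕ p ≡ᵇ toℕ q) *_) (count-eqV ks v)) ⟩
  ∑[ q < k ] (ind (toℕ p ≡ᵇ toℕ q) * 1)
    ≡⟨ ∑-point-* k (toℕ p) 1 (toℕ<n p) ⟩
  1 ∎
  where open ≡-Reasoning

count-stepShape : ∀ {n} k (ks : Vec ℕ n) (p : Fin k) v (x : Fin k → Bool) (y : Vertex ks → Bool) →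
  (T (x p) → ⊥) →
  ∑[ q < k ] count ks (λ u → stepShape ks (x q) p q v u (y u)) ≡ ∑[ q < k ] ind (x q) + count ks y
count-stepShape k ks p v x y ¬xp = begin
  ∑[ q < k ] count ks (λ u → stepShape ks (x q) p q v u (y u))
    ≡⟨ sum-cong-≗ {k} (λ q → Σᵛ-cong ks (λ u → ind-stepShape q u)) ⟩
  ∑[ q < k ] Σᵛ ks (λ u → ind (x q) * ind (eqV ks v u) + ind (toℕ p ≡ᵇ toℕ q) * ind (y u))
    ≡⟨ sum-cong-≗ {k} slice ⟩
  ∑[ q < k ] (ind (x q) + ind (toℕ p ≡ᵇ toℕ q) * count ks y)
    ≡⟨ ∑-distrib-+ (λ q → ind (x q)) (λ q → ind (toℕ p ≡ᵇ toℕ q) * count ks y) ⟩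
  ∑[ q < k ] ind (x q) + ∑[ q < k ] (ind (toℕ p ≡ᵇ toℕ q) * count ks y)
    ≡⟨ cong (∑[ q < k ] ind (x q) +_) (∑-point-* k (toℕ p) (count ks y) (toℕ<n p)) ⟩
  ∑[ q < k ] ind (x q) + count ks y ∎
  where
  open ≡-Reasoning
  -- A step of x never stays at p.
  exclusive : ∀ q u → T (x q ∧ eqV ks v u) → T ((toℕ p ≡ᵇ toℕ q) ∧ y u) → ⊥
  exclusive q u xq pq with Equivalence.to (toℕ-≡ᵇ⇔≡ {p = p} {q}) (T-∧ˡ pq)
  ... | refl = ¬xp (T-∧ˡ xq)
  ind-stepShape : ∀ q u → ind (stepShape ks (x q) p q v u (y u))
                        ≡ ind (x q) * ind (eqV ks v u) + ind (toℕ p ≡ᵇ toℕ q) * ind (y u)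
  ind-stepShape q u = trans (ind-∨ (x q ∧ eqV ks v u) _ (exclusive q u))
                            (cong₂ _+_ (ind-∧ (x q) _) (ind-∧ (toℕ p ≡ᵇ toℕ q) _))
  slice : ∀ q → Σᵛ ks (λ u → ind (x q) * ind (eqV ks v u) + ind (toℕ p ≡ᵇ toℕ q) * ind (y u))
              ≡ ind (x q) + ind (toℕ p ≡ᵇ toℕ q) * count ks y
  slice q = begin
    Σᵛ ks (λ u → ind (x q) * ind (eqV ks v u) + ind (toℕ p ≡ᵇ toℕ q) * ind (y u))
      ≡⟨ Σᵛ-distrib-+ ks _ _ ⟩
    Σᵛ ks (λ u → ind (x q) * ind (eqV ks v u)) + Σᵛ ks (λ u → ind (toℕ p ≡ᵇ toℕ q) * ind (y u))
      ≡⟨ cong₂ _+_ (*-distribˡ-Σᵛ ks (ind (x q)) _) (*-distribˡ-Σᵛ ks (ind (toℕ p ≡ᵇ toℕ q)) _) ⟨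
    ind (x q) * count ks (eqV ks v) + ind (toℕ p ≡ᵇ toℕ q) * count ks y
      ≡⟨ cong (λ c → ind (x q) * c + _) (count-eqV ks v) ⟩
    ind (x q) * 1 + ind (toℕ p ≡ᵇ toℕ q) * count ks y
      ≡⟨ cong (_+ _) (*-identityʳ (ind (x q))) ⟩
    ind (x q) + ind (toℕ p ≡ᵇ toℕ q) * count ks y ∎

adj-sym : ∀ {n} (ks : Vec ℕ n) {v u} → Adj ks v u → Adj ks u v
adj-sym (k ∷ ks) {p , v} {q , u} vu with Equivalence.to (stepShape⇔ ks _ p q v u _) vu
... | inj₁ (d , refl)  = Equivalence.from (stepShape⇔ ks _ q p u v _) (inj₁ (diff1-sym (toℕ p) (toℕ q) d , refl))
... | inj₂ (refl , a)  = Equivalence.from (stepShape⇔ ks _ q p u v _) (inj₂ (refl , adj-sym ks a))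

-- W = Σᵢ Πⱼ≠ᵢ kⱼ, so that 1/k₁ + … + 1/kₙ = W / P.
W : ∀ {n} → Vec ℕ n → ℕ
W []       = 0
W (k ∷ ks) = P ks + k * W ks

deg : ∀ {n} (ks : Vec ℕ n) → Vertex ks → ℕ
deg ks v = count ks (adjB ks v)

pathDeg : ∀ k → Fin k → ℕ
pathDeg k p = ∑[ q < k ] ind (diff1 (toℕ p) (toℕ q))

deg-cons : ∀ {n} k (ks : Vec ℕ n) p v → deg (k ∷ ks) (p , v) ≡ pathDeg k p + deg ks v
deg-cons k ks p v = count-stepShape k ks p v (λ q → diff1 (toℕ p) (toℕ q)) (adjB ks v) (diff1-irrefl (toℕ p))

-- The path P_k has k ∸ 1 edges, each counted here at its upper end.
path-edges : ∀ k → ∑[ p < k ] ∑[ q < k ] ind (suc (toℕ q) ≡ᵇ toℕ p) ≡ k ∸ 1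
path-edges zero    = refl
path-edges (suc k) = begin
  ∑[ q < suc k ] 0 + ∑[ p < k ] ∑[ q < suc k ] ind (toℕ q ≡ᵇ toℕ p)
    ≡⟨ cong₂ _+_ (trans (∑-const (suc k) 0) (*-zeroʳ (suc k)))
                 (sum-cong-≗ {k} (λ p → sum-cong-≗ {suc k} (λ q → cong ind (≡ᵇ-sym (toℕ q) (toℕ p))))) ⟩
  ∑[ p < k ] ∑[ q < suc k ] ind (toℕ p ≡ᵇ toℕ q)
    ≡⟨ sum-cong-≗ {k} (λ p → ∑-point (suc k) (toℕ p) (m<n⇒m<1+n (toℕ<n p))) ⟩
  ∑[ p < k ] 1
    ≡⟨ trans (∑-const k 1) (*-identityʳ k) ⟩
  k ∎
  where open ≡-Reasoning

pathDeg-sum : ∀ k → ∑[ p < k ] pathDeg k p ≡ (k ∸ 1) + (k ∸ 1)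
pathDeg-sum k = begin
  ∑[ p < k ] ∑[ q < k ] ind (diff1 (toℕ p) (toℕ q))
    ≡⟨ sum-cong-≗ {k} (λ p → sum-cong-≗ {k} (λ q → ind-∨ _ _ (diff1-excl (toℕ p) (toℕ q)))) ⟩
  ∑[ p < k ] ∑[ q < k ] (up p q + up q p)
    ≡⟨ sum-cong-≗ {k} (λ p → ∑-distrib-+ (λ q → up p q) (λ q → up q p)) ⟩
  ∑[ p < k ] (∑[ q < k ] up p q + ∑[ q < k ] up q p)
    ≡⟨ ∑-distrib-+ (λ p → ∑[ q < k ] up p q) (λ p → ∑[ q < k ] up q p) ⟩
  ∑[ p < k ] ∑[ q < k ] up p q + ∑[ p < k ] ∑[ q < k ] up q p
    ≡⟨ cong₂ _+_ (trans (∑-comm (λ p q → up p q)) (path-edges k)) (path-edges k) ⟩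
  (k ∸ 1) + (k ∸ 1) ∎
  where
  open ≡-Reasoning
  up : Fin k → Fin k → ℕ
  up p q = ind (suc (toℕ p) ≡ᵇ toℕ q)

Σdeg-cons : ∀ {n} k (ks : Vec ℕ n) →
  Σᵛ (k ∷ ks) (deg (k ∷ ks)) ≡ P ks * ((k ∸ 1) + (k ∸ 1)) + k * Σᵛ ks (deg ks)
Σdeg-cons k ks = begin
  ∑[ p < k ] Σᵛ ks (λ v → deg (k ∷ ks) (p , v))
    ≡⟨ sum-cong-≗ {k} (λ p → Σᵛ-cong ks (deg-cons k ks p)) ⟩
  ∑[ p < k ] Σᵛ ks (λ v → pathDeg k p + deg ks v)
    ≡⟨ sum-cong-≗ {k} (λ p → trans (Σᵛ-distrib-+ ks _ (deg ks)) (cong (_+ Σᵛ ks (deg ks)) (Σᵛ-const ks (pathDeg k p)))) ⟩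
  ∑[ p < k ] (P ks * pathDeg k p + Σᵛ ks (deg ks))
    ≡⟨ ∑-distrib-+ (λ p → P ks * pathDeg k p) (λ _ → Σᵛ ks (deg ks)) ⟩
  ∑[ p < k ] (P ks * pathDeg k p) + ∑[ p < k ] Σᵛ ks (deg ks)
    ≡⟨ cong₂ _+_ (trans (sym (*-distribˡ-sum {k} (P ks) (pathDeg k))) (cong (P ks *_) (pathDeg-sum k))) (∑-const k _) ⟩
  P ks * ((k ∸ 1) + (k ∸ 1)) + k * Σᵛ ks (deg ks) ∎
  where open ≡-Reasoning

degree-sum : ∀ {n} (ks : Vec ℕ n) → All (1 ≤_) ks → Σᵛ ks (deg ks) + 2 * W ks ≡ 2 * n * P ks
degree-sum []            []       = refl
degree-sum {suc n} (suc k ∷ ks) (_ ∷ pos) = begin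
  Σᵛ (suc k ∷ ks) (deg (suc k ∷ ks)) + 2 * W (suc k ∷ ks)
    ≡⟨ cong (_+ 2 * W (suc k ∷ ks)) (Σdeg-cons (suc k) ks) ⟩
  P ks * (k + k) + suc k * Σᵛ ks (deg ks) + 2 * (P ks + suc k * W ks)
    ≡⟨ solve 4 (λ p k d w → p :* (k :+ k) :+ (con 1 :+ k) :* d :+ con 2 :* (p :+ (con 1 :+ k) :* w)
                         := con 2 :* (con 1 :+ k) :* p :+ (con 1 :+ k) :* (d :+ con 2 :* w))
               refl (P ks) k (Σᵛ ks (deg ks)) (W ks) ⟩
  2 * suc k * P ks + suc k * (Σᵛ ks (deg ks) + 2 * W ks)
    ≡⟨ cong (λ x → 2 * suc k * P ks + suc k * x) (degree-sum ks pos) ⟩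
  2 * suc k * P ks + suc k * (2 * n * P ks)
    ≡⟨ solve 3 (λ p k n → con 2 :* (con 1 :+ k) :* p :+ (con 1 :+ k) :* (con 2 :* n :* p)
                        := con 2 :* (con 1 :+ n) :* ((con 1 :+ k) :* p)) refl (P ks) k n ⟩
  2 * suc n * P (suc k ∷ ks) ∎
  where open ≡-Reasoning

-- Every edge is counted by the outdegree of exactly one of its ends, so the
-- outdegrees of an orientation add up to half the degree sum.
outdeg-sum : ∀ {n} {ks : Vec ℕ n} (o : Orientation ks) →
  Σᵛ ks (outdeg o) + Σᵛ ks (outdeg o) ≡ Σᵛ ks (deg ks)
outdeg-sum {ks = ks} o = begin
  Σᵛ ks (outdeg o) + Σᵛ ks (λ v → Σᵛ ks (λ u → ind (arc v u)))
    ≡⟨ cong (Σᵛ ks (outdeg o) +_) (Σᵛ-comm ks ks (λ v u → ind (arc v u))) ⟩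
  Σᵛ ks (outdeg o) + Σᵛ ks (λ v → Σᵛ ks (λ u → ind (arc u v)))
    ≡⟨ Σᵛ-distrib-+ ks (outdeg o) _ ⟨
  Σᵛ ks (λ v → outdeg o v + Σᵛ ks (λ u → ind (arc u v)))
    ≡⟨ Σᵛ-cong ks (λ v → sym (Σᵛ-distrib-+ ks _ _)) ⟩
  Σᵛ ks (λ v → Σᵛ ks (λ u → ind (arc v u) + ind (arc u v)))
    ≡⟨ Σᵛ-cong ks (λ v → Σᵛ-cong ks (λ u → edge v u)) ⟩
  Σᵛ ks (deg ks) ∎
  where
  open ≡-Reasoning
  open Orientation o
  edge : ∀ v u → ind (arc v u) + ind (arc u v) ≡ ind (adjB ks v u)
  edge v u = ind-partition (arc⇒adj v u) (adj-sym ks ∘ arc⇒adj u v) (oriented v u) (antisym v u)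

-- Necessity: outdegrees of at least m = n - 1 force W ≤ P, because
-- 2 P m ≤ 2 Σ outdeg = Σ deg = 2 n P - 2 W.
necessity : ∀ m (ks : Vec ℕ (suc m)) → All (1 ≤_) ks → (o : Orientation ks) →
  (∀ v → m ≤ outdeg o v) → W ks ≤ P ks
necessity m ks pos o m≤out = *-cancelˡ-≤ 2 (+-cancelˡ-≤ (2 * (P ks * m)) _ _ (begin
  2 * (P ks * m) + 2 * W ks
    ≤⟨ +-monoˡ-≤ (2 * W ks) (*-monoʳ-≤ 2 lower-bound) ⟩
  2 * Σᵛ ks (outdeg o) + 2 * W ks
    ≡⟨ cong (λ x → x + 2 * W ks) (trans (cong (Σᵛ ks (outdeg o) +_) (+-identityʳ _)) (outdeg-sum o)) ⟩
  Σᵛ ks (deg ks) + 2 * W ks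
    ≡⟨ degree-sum ks pos ⟩
  2 * suc m * P ks
    ≡⟨ solve 2 (λ m p → con 2 :* (con 1 :+ m) :* p := con 2 :* (p :* m) :+ con 2 :* p) refl m (P ks) ⟩
  2 * (P ks * m) + 2 * P ks ∎))
  where
  open ≤-Reasoning
  lower-bound : P ks * m ≤ Σᵛ ks (outdeg o)
  lower-bound = ≤-trans (≤-reflexive (sym (Σᵛ-const ks m))) (Σᵛ-mono ks m≤out)

-- The path P_k oriented towards a sink s: a → b is an arc when b is the
-- neighbour of a on the side of s.
towardsᵖ : ℕ → ℕ → ℕ → Bool
towardsᵖ s a b = ((a <ᵇ s) ∧ (suc a ≡ᵇ b)) ∨ ((s <ᵇ a) ∧ (a ≡ᵇ suc b))

towardsᵖ⇔ : ∀ s a b → T (towardsᵖ s a b) ⇔ ((a < s × suc a ≡ b) ⊎ (s < a × a ≡ suc b))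
towardsᵖ⇔ s a b =
  (((<ᵇ⇔< {a} {s} ×-⇔ ≡ᵇ⇔≡ {suc a} {b}) ⇔-∘ T-∧) ⊎-⇔ ((<ᵇ⇔< {s} {a} ×-⇔ ≡ᵇ⇔≡ {a} {suc b}) ⇔-∘ T-∧)) ⇔-∘ T-∨

towardsᵖ⇒diff1 : ∀ s a b → T (towardsᵖ s a b) → T (diff1 a b)
towardsᵖ⇒diff1 s a b t = Equivalence.from (diff1⇔ a b) (Data.Sum.map proj₂ (sym ∘ proj₂) (Equivalence.to (towardsᵖ⇔ s a b) t))

towardsᵖ-total : ∀ s a b → T (diff1 a b) → T (towardsᵖ s a b) ⊎ T (towardsᵖ s b a)
towardsᵖ-total s a b d with Equivalence.to (diff1⇔ a b) d
... | inj₁ refl with a <? s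
...   | yes a<s = inj₁ (Equivalence.from (towardsᵖ⇔ s a b) (inj₁ (a<s , refl)))
...   | no  a≮s = inj₂ (Equivalence.from (towardsᵖ⇔ s b a) (inj₂ (s≤s (≮⇒≥ a≮s) , refl)))
towardsᵖ-total s a b d | inj₂ refl with b <? s
...   | yes b<s = inj₂ (Equivalence.from (towardsᵖ⇔ s b a) (inj₁ (b<s , refl)))
...   | no  b≮s = inj₁ (Equivalence.from (towardsᵖ⇔ s a b) (inj₂ (s≤s (≮⇒≥ b≮s) , refl)))

towardsᵖ-antisym : ∀ s a b → T (towardsᵖ s a b) → T (towardsᵖ s b a) → ⊥
towardsᵖ-antisym s a b ab ba with Equivalence.to (towardsᵖ⇔ s a b) ab | Equivalence.to (towardsᵖ⇔ s b a) ba
... | inj₁ (_ , refl)   | inj₁ (_ , e)       = <-asym (n<1+n a) (≤-reflexive e)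
... | inj₁ (a<s , refl) | inj₂ (s<1+a , _)   = <⇒≱ a<s (m<1+n⇒m≤n s<1+a)
... | inj₂ (s<1+b , refl) | inj₁ (b<s , _)   = <⇒≱ b<s (m<1+n⇒m≤n s<1+b)
... | inj₂ (_ , refl)   | inj₂ (_ , e)       = <-asym (n<1+n b) (≤-reflexive (sym e))

trichotomyᵇ : ∀ a s → ind (a <ᵇ s) + ind (s <ᵇ a) + ind (a ≡ᵇ s) ≡ 1
trichotomyᵇ zero    zero    = refl
trichotomyᵇ zero    (suc s) = refl
trichotomyᵇ (suc a) zero    = refl
trichotomyᵇ (suc a) (suc s) = trichotomyᵇ a s

towardsᵖ-outdeg : ∀ k a s → a < k → s < k → ∑[ q < k ] ind (towardsᵖ s a (toℕ q)) + ind (a ≡ᵇ s) ≡ 1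
towardsᵖ-outdeg k a s a<k s<k = begin
  ∑[ q < k ] ind (towardsᵖ s a (toℕ q)) + ind (a ≡ᵇ s)
    ≡⟨ cong (_+ ind (a ≡ᵇ s)) (trans (sum-cong-≗ {k} (λ q → ind-∨ _ _ exclusive))
                                     (∑-distrib-+ {k} (λ q → ind ((a <ᵇ s) ∧ (suc a ≡ᵇ toℕ q))) (λ q → ind ((s <ᵇ a) ∧ (a ≡ᵇ suc (toℕ q)))))) ⟩
  ∑[ q < k ] ind ((a <ᵇ s) ∧ (suc a ≡ᵇ toℕ q)) + ∑[ q < k ] ind ((s <ᵇ a) ∧ (a ≡ᵇ suc (toℕ q))) + ind (a ≡ᵇ s)
    ≡⟨ cong (λ x → x + ind (a ≡ᵇ s)) (cong₂ _+_ (∑-point-if k (suc a) (a <ᵇ s) (λ t → <-≤-trans (s≤s (<ᵇ⇒< a s t)) s<k)) (below a a<k)) ⟩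
  ind (a <ᵇ s) + ind (s <ᵇ a) + ind (a ≡ᵇ s)
    ≡⟨ trichotomyᵇ a s ⟩
  1 ∎
  where
  open ≡-Reasoning
  exclusive : ∀ {x y} → T ((a <ᵇ s) ∧ x) → T ((s <ᵇ a) ∧ y) → ⊥
  exclusive up down = <-asym (<ᵇ⇒< a s (T-∧ˡ up)) (<ᵇ⇒< s a (T-∧ˡ down))
  below : ∀ a → a < k → ∑[ q < k ] ind ((s <ᵇ a) ∧ (a ≡ᵇ suc (toℕ q))) ≡ ind (s <ᵇ a)
  below zero    _   = trans (∑-const k 0) (*-zeroʳ k)
  below (suc a) a<k = ∑-point-if k a (s <ᵇ suc a) (λ _ → <-trans (n<1+n a) a<k)

-- A sink rule chooses a sink on every line of H: the lines in the first
-- direction are indexed by the rest v, and each slice p of the first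
-- coordinate carries a sink rule for the remaining coordinates.
SinkRule : ∀ {n} → Vec ℕ n → Set
SinkRule []       = ⊤
SinkRule (k ∷ ks) = (Vertex ks → Fin k) × (Fin k → SinkRule ks)

towards : ∀ {n} (ks : Vec ℕ n) → SinkRule ks → Vertex ks → Vertex ks → Bool
towards []       _       _       _       = false
towards (k ∷ ks) (s , S) (p , v) (q , u) =
  stepShape ks (towardsᵖ (toℕ (s v)) (toℕ p) (toℕ q)) p q v u (towards ks (S p) v u)

sinks : ∀ {n} (ks : Vec ℕ n) → SinkRule ks → Vertex ks → ℕ
sinks []       _       _       = 0
sinks (k ∷ ks) (s , S) (p , v) = ind (toℕ p ≡ᵇ toℕ (s v)) + sinks ks (S p) v

towards⇒adj : ∀ {n} (ks : Vec ℕ n) S v u → T (towards ks S v u) → Adj ks v u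
towards⇒adj (k ∷ ks) (s , S) (p , v) (q , u) t with Equivalence.to (stepShape⇔ ks _ p q v u _) t
... | inj₁ (st , refl) = Equivalence.from (stepShape⇔ ks _ p q v v _)
                           (inj₁ (towardsᵖ⇒diff1 (toℕ (s v)) (toℕ p) (toℕ q) st , refl))
... | inj₂ (refl , t′) = Equivalence.from (stepShape⇔ ks _ p p v u _) (inj₂ (refl , towards⇒adj ks (S p) v u t′))

towards-total : ∀ {n} (ks : Vec ℕ n) S v u → Adj ks v u → T (towards ks S v u) ⊎ T (towards ks S u v)
towards-total (k ∷ ks) (s , S) (p , v) (q , u) a with Equivalence.to (stepShape⇔ ks _ p q v u _) a
... | inj₁ (d , refl) = Data.Sum.map (λ st → Equivalence.from (stepShape⇔ ks _ p q v v _) (inj₁ (st , refl)))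
                                     (λ st → Equivalence.from (stepShape⇔ ks _ q p v v _) (inj₁ (st , refl)))
                                     (towardsᵖ-total (toℕ (s v)) (toℕ p) (toℕ q) d)
... | inj₂ (refl , a′) = Data.Sum.map (λ t → Equivalence.from (stepShape⇔ ks _ p p v u _) (inj₂ (refl , t)))
                                      (λ t → Equivalence.from (stepShape⇔ ks _ p p u v _) (inj₂ (refl , t)))
                                      (towards-total ks (S p) v u a′)

towards-antisym : ∀ {n} (ks : Vec ℕ n) S v u → T (towards ks S v u) → T (towards ks S u v) → ⊥
towards-antisym (k ∷ ks) (s , S) (p , v) (q , u) vu uv
  with Equivalence.to (stepShape⇔ ks _ p q v u _) vu | Equivalence.to (stepShape⇔ ks _ q p u v _) uv
... | inj₁ (st , refl) | inj₁ (st′ , _)  = towardsᵖ-antisym (toℕ (s v)) (toℕ p) (toℕ q) st st′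
... | inj₁ (st , refl) | inj₂ (refl , _) = diff1-irrefl (toℕ p) (towardsᵖ⇒diff1 (toℕ (s v)) (toℕ p) (toℕ p) st)
... | inj₂ (refl , _)  | inj₁ (st , refl) = diff1-irrefl (toℕ p) (towardsᵖ⇒diff1 (toℕ (s u)) (toℕ p) (toℕ p) st)
... | inj₂ (refl , t)  | inj₂ (_ , t′)    = towards-antisym ks (S p) v u t t′

towardsOrientation : ∀ {n} (ks : Vec ℕ n) → SinkRule ks → Orientation ks
towardsOrientation ks S = record
  { arc      = towards ks S
  ; arc⇒adj  = towards⇒adj ks S
  ; oriented = towards-total ks S
  ; antisym  = towards-antisym ks S
  }

outdeg-towards : ∀ {n} (ks : Vec ℕ n) S v → count ks (towards ks S v) + sinks ks S v ≡ n
outdeg-towards []       S       v       = refl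
outdeg-towards {suc n} (k ∷ ks) (s , S) (p , v) = begin
  count (k ∷ ks) (towards (k ∷ ks) (s , S) (p , v)) + (here + sinks ks (S p) v)
    ≡⟨ cong (_+ (here + sinks ks (S p) v))
            (count-stepShape k ks p v (towardsᵖ (toℕ (s v)) (toℕ p) ∘ toℕ) (towards ks (S p) v)
                             (diff1-irrefl (toℕ p) ∘ towardsᵖ⇒diff1 (toℕ (s v)) (toℕ p) (toℕ p))) ⟩
  (∑[ q < k ] ind (towardsᵖ (toℕ (s v)) (toℕ p) (toℕ q)) + count ks (towards ks (S p) v))
    + (here + sinks ks (S p) v)
    ≡⟨ interchange (∑[ q < k ] ind (towardsᵖ (toℕ (s v)) (toℕ p) (toℕ q))) (count ks (towards ks (S p) v)) here (sinks ks (S p) v) ⟩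
  (∑[ q < k ] ind (towardsᵖ (toℕ (s v)) (toℕ p) (toℕ q)) + here)
    + (count ks (towards ks (S p) v) + sinks ks (S p) v)
    ≡⟨ cong₂ _+_ (towardsᵖ-outdeg k (toℕ p) (toℕ (s v)) (toℕ<n p) (toℕ<n (s v))) (outdeg-towards ks (S p) v) ⟩
  suc n ∎
  where
  open ≡-Reasoning
  here : ℕ
  here = ind (toℕ p ≡ᵇ toℕ (s v))

[m%d+n]%d≡[m+n]%d : ∀ m n d .{{_ : NonZero d}} → (m % d + n) % d ≡ (m + n) % d
[m%d+n]%d≡[m+n]%d m n d = begin
  (m % d + n) % d         ≡⟨ %-distribˡ-+ (m % d) n d ⟩
  (m % d % d + n % d) % d ≡⟨ cong (λ x → (x + n % d) % d) (m%n%n≡m%n m d) ⟩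
  (m % d + n % d) % d     ≡⟨ %-distribˡ-+ m n d ⟨
  (m + n) % d             ∎
  where open ≡-Reasoning

negMod : ∀ k .{{_ : NonZero k}} → ℕ → Fin k
negMod (suc k) a = (k * a) mod suc k

negMod-cancel : ∀ k .{{_ : NonZero k}} a → (a + toℕ (negMod k a)) % k ≡ 0
negMod-cancel (suc k) a = begin
  (a + toℕ ((k * a) mod suc k)) % suc k ≡⟨ cong (λ x → (a + x) % suc k) (toℕ-fromℕ< (m%n<n (k * a) (suc k))) ⟩
  (a + (k * a) % suc k) % suc k         ≡⟨ cong (_% suc k) (+-comm a _) ⟩
  ((k * a) % suc k + a) % suc k         ≡⟨ [m%d+n]%d≡[m+n]%d (k * a) a (suc k) ⟩
  (k * a + a) % suc k                   ≡⟨ cong (_% suc k) (+-comm (k * a) a) ⟩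
  (suc k * a) % suc k                   ≡⟨ cong (_% suc k) (*-comm (suc k) a) ⟩
  (a * suc k) % suc k                   ≡⟨ m*n%n≡0 a (suc k) ⟩
  0                                     ∎
  where open ≡-Reasoning

window-shift : ∀ x A w M .{{_ : NonZero M}} → x < M → A + w ≤ M → (x + (M ∸ A)) % M < w →
  A ≤ x × x < A + w
window-shift x A w M x<M A+w≤M inWindow with A ≤? x
... | yes A≤x = A≤x , (begin-strict
  x               ≡⟨ m+[n∸m]≡n A≤x ⟨
  A + (x ∸ A)     <⟨ +-monoʳ-< A (subst (_< w) distance inWindow) ⟩
  A + w           ∎)
  where
  open ≤-Reasoning
  distance : (x + (M ∸ A)) % M ≡ x ∸ A
  distance = begin-equality
    (x + (M ∸ A)) % M       ≡⟨ cong (_% M) (+-∸-assoc x A≤M) ⟨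
    (x + M ∸ A) % M         ≡⟨ cong (_% M) (+-∸-comm M A≤x) ⟩
    (x ∸ A + M) % M         ≡⟨ [m+n]%n≡m%n (x ∸ A) M ⟩
    (x ∸ A) % M             ≡⟨ m<n⇒m%n≡m (≤-<-trans (m∸n≤m x A) x<M) ⟩
    x ∸ A                   ∎
    where
    A≤M : A ≤ M
    A≤M = ≤-trans (m≤m+n A w) A+w≤M
... | no A≰x = ⊥-elim (<⇒≱ inWindow (begin
  w                       ≡⟨ m+n∸m≡n A w ⟨
  A + w ∸ A               ≤⟨ ∸-monoˡ-≤ A A+w≤M ⟩
  M ∸ A                   ≤⟨ m≤n+m (M ∸ A) x ⟩
  x + (M ∸ A)             ≡⟨ m<n⇒m%n≡m noWrap ⟨
  (x + (M ∸ A)) % M       ∎))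
  where
  open ≤-Reasoning
  noWrap : x + (M ∸ A) < M
  noWrap = subst (x + (M ∸ A) <_) (m+[n∸m]≡n (≤-trans (m≤m+n A w) A+w≤M)) (+-monoˡ-< (M ∸ A) (≰⇒> A≰x))

-- On a line whose k vertices have hashes r, r + w, …, r + (k-1) w modulo
-- M = k w, the vertex at position sinkAt has its hash in the window [A, A + w).
sinkAt : ∀ k w .{{_ : NonZero k}} .{{_ : NonZero w}} (M r A : ℕ) → Fin k
sinkAt k w M r A = negMod k ((r + (M ∸ A)) / w)

window-hit : ∀ k w .{{_ : NonZero k}} .{{_ : NonZero w}} M {{_ : NonZero M}} r A →
  M ≡ k * w → A + w ≤ M →
  let x = (r + toℕ (sinkAt k w M r A) * w) % M in A ≤ x × x < A + w
window-hit k w M r A refl A+w≤M =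
  window-shift ((r + p * w) % M) A w M (m%n<n (r + p * w) M) A+w≤M (m/n≡0⇒m<n quotient≡0)
  where
  p : ℕ
  p = toℕ (sinkAt k w M r A)
  a : ℕ
  a = (r + (M ∸ A)) / w
  X : ℕ
  X = r + (M ∸ A) + p * w
  quotient≡0 : ((r + p * w) % M + (M ∸ A)) % M / w ≡ 0
  quotient≡0 = begin
    ((r + p * w) % M + (M ∸ A)) % M / w ≡⟨ cong (_/ w) ([m%d+n]%d≡[m+n]%d (r + p * w) (M ∸ A) M) ⟩
    (r + p * w + (M ∸ A)) % M / w       ≡⟨ cong (λ y → y % M / w) (xy∙z≈xz∙y r (p * w) (M ∸ A)) ⟩
    X % M / w                           ≡⟨ m%[n*o]/o≡m/o%n X k w ⟩
    X / w % k                           ≡⟨ cong (_% k) (+-distrib-/-∣ʳ (r + (M ∸ A)) (n∣m*n p)) ⟩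
    (a + p * w / w) % k                 ≡⟨ cong (λ y → (a + y) % k) (m*n/n≡m p w) ⟩
    (a + p) % k                         ≡⟨ negMod-cancel k a ⟩
    0                                   ∎
    where open ≡-Reasoning

P-nonZero : ∀ {n} {ks : Vec ℕ n} → All (1 ≤_) ks → NonZero (P ks)
P-nonZero []                = _
P-nonZero {ks = k ∷ ks} (k≥1 ∷ pos) = m*n≢0 k (P ks) {{>-nonZero k≥1}} {{P-nonZero pos}}

-- The hash Σᵢ pᵢ wᵢ of a vertex, with weight wᵢ = m Πⱼ≠ᵢ kⱼ for coordinate i;
-- the factor m accumulates the side lengths of the coordinates already
-- passed.
hash : ∀ {n} (ks : Vec ℕ n) → ℕ → Vertex ks → ℕ
hash []       m _       = 0
hash (k ∷ ks) m (p , v) = toℕ p * (m * P ks) + hash ks (m * k) v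

-- The sink rule in which direction i owns the window of length wᵢ in ℤ/M
-- starting at A (the windows following each other), and the sink of a line is
-- its vertex whose hash lies in the window. The argument c is the hash
-- contribution of the coordinates already fixed.
hashRule : ∀ {n} (ks : Vec ℕ n) → All (1 ≤_) ks → (M m : ℕ) {{_ : NonZero m}} → (A c : ℕ) → SinkRule ks
hashRule []           []        M m A c = tt
hashRule (suc k ∷ ks) (_ ∷ pos) M m {{m≢0}} A c =
    (λ v → sinkAt (suc k) (m * P ks) M (c + hash ks (m * suc k) v) A)
  , (λ p → hashRule ks pos M (m * suc k) {{m*n≢0 m (suc k)}} (A + m * P ks) (c + toℕ p * (m * P ks)))
  where
  instance
    weight≢0 : NonZero (m * P ks)
    weight≢0 = m*n≢0 m (P ks) {{m≢0}} {{P-nonZero pos}}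

-- If the windows fit disjointly into ℤ/M, a vertex is a sink in at most one
-- direction, since being the sink in a direction puts its hash into that
-- direction's window; in particular no vertex whose hash precedes all the
-- windows is a sink.
sinks-hashRule : ∀ {n} (ks : Vec ℕ n) (pos : All (1 ≤_) ks) M {{_ : NonZero M}} m {{_ : NonZero m}} A c v →
  M ≡ m * P ks → A + m * W ks ≤ M →
  sinks ks (hashRule ks pos M m A c) v ≤ 1 ×
  ((c + hash ks m v) % M < A → sinks ks (hashRule ks pos M m A c) v ≡ 0)
sinks-hashRule []           []        M m A c _ _ _ = z≤n , λ _ → refl
sinks-hashRule (suc k ∷ ks) (_ ∷ pos) M m {{m≢0}} A c (p , v) M≡ fits = by-first-direction (toℕ p ≡ᵇ toℕ s) refl
  where
  w : ℕ
  w = m * P ks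
  instance
    weight≢0 : NonZero w
    weight≢0 = m*n≢0 m (P ks) {{m≢0}} {{P-nonZero pos}}
  r : ℕ
  r = c + hash ks (m * suc k) v
  s : Fin (suc k)
  s = sinkAt (suc k) w M r A
  rest : ℕ
  rest = sinks ks (hashRule ks pos M (m * suc k) {{m*n≢0 m (suc k)}} (A + w) (c + toℕ p * w)) v
  h : ℕ
  h = c + hash (suc k ∷ ks) m (p , v)
  rest-fact : rest ≤ 1 × ((c + toℕ p * w + hash ks (m * suc k) v) % M < A + w → rest ≡ 0)
  rest-fact = sinks-hashRule ks pos M (m * suc k) {{m*n≢0 m (suc k)}} (A + w) (c + toℕ p * w) v
    (trans M≡ (sym (*-assoc m (suc k) (P ks))))
    (subst (_≤ M) (solve 5 (λ A m k p W → A :+ m :* (p :+ k :* W) := A :+ m :* p :+ m :* k :* W)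
                            refl A m (suc k) (P ks) (W ks)) fits)
  rest≡0 : h % M < A + w → rest ≡ 0
  rest≡0 h<A+w = proj₂ rest-fact (subst (λ x → x % M < A + w) (sym (+-assoc c (toℕ p * w) _)) h<A+w)
  in-window : toℕ p ≡ toℕ s → A ≤ h % M × h % M < A + w
  in-window p≡s = subst (λ x → A ≤ x % M × x % M < A + w) (sym h≡) (window-hit (suc k) w M r A M≡kw A+w≤M)
    where
    M≡kw : M ≡ suc k * w
    M≡kw = trans M≡ (solve 3 (λ m k p → m :* (k :* p) := k :* (m :* p)) refl m (suc k) (P ks))
    A+w≤M : A + w ≤ M
    A+w≤M = ≤-trans (+-monoʳ-≤ A (*-monoʳ-≤ m (m≤m+n (P ks) _))) fits
    h≡ : h ≡ r + toℕ s * w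
    h≡ = trans (sym (+-assoc c (toℕ p * w) _)) (trans (xy∙z≈xz∙y c _ _) (cong (λ x → r + x * w) p≡s))

  by-first-direction : ∀ b → b ≡ (toℕ p ≡ᵇ toℕ s) → ind b + rest ≤ 1 × (h % M < A → ind b + rest ≡ 0)
  by-first-direction true  b≡ = s≤s (≤-reflexive (rest≡0 (proj₂ window))) , λ h<A → ⊥-elim (<⇒≱ h<A (proj₁ window))
    where
    window : A ≤ h % M × h % M < A + w
    window = in-window (≡ᵇ⇒≡ (toℕ p) (toℕ s) (subst T b≡ tt))
  by-first-direction false _  = proj₁ rest-fact , λ h<A → rest≡0 (<-≤-trans h<A (m≤m+n A w))

outdeg-choice : ∀ d s n → d + s ≡ n → s ≤ 1 → d ≡ n ∸ 1 ⊎ d ≡ n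
outdeg-choice d zero          n refl _        = inj₂ (sym (+-identityʳ d))
outdeg-choice d (suc zero)    n refl _        = inj₁ (sym (m+n∸n≡m d 1))
outdeg-choice d (suc (suc s)) n _    (s≤s ())

-- Sufficiency: if W ≤ P, the windows of lengths P / kᵢ fit disjointly into
-- ℤ/P, and orienting every line towards its hash-chosen sink leaves each
-- vertex at most one direction without an out-neighbour.
sufficiency : ∀ n (ks : Vec ℕ n) → All (1 ≤_) ks → W ks ≤ P ks →
  Σ (Orientation ks) (λ o → (v : Vertex ks) → OutdegreeIs o v (n ∸ 1) ⊎ OutdegreeIs o v n)
sufficiency n ks pos W≤P = towardsOrientation ks S , λ v →
  Data.Sum.map (Equivalence.from (outdegree-count (towardsOrientation ks S) v (n ∸ 1)) ∘ sym)
               (Equivalence.from (outdegree-count (towardsOrientation ks S) v n) ∘ sym)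
               (outdeg-choice _ _ n (outdeg-towards ks S v) (at-most-one-sink v))
  where
  instance
    P≢0 : NonZero (P ks)
    P≢0 = P-nonZero pos
  S : SinkRule ks
  S = hashRule ks pos (P ks) 1 0 0
  at-most-one-sink : ∀ v → sinks ks S v ≤ 1
  at-most-one-sink v = proj₁ (sinks-hashRule ks pos (P ks) 1 0 0 v
    (sym (*-identityˡ (P ks))) (subst (_≤ P ks) (sym (*-identityˡ (W ks))) W≤P))

-- P ≥ 1, so that W / P has the positive denominator (P ∸ 1) + 1.
P≥1 : ∀ {n} {ks : Vec ℕ n} → All (1 ≤_) ks → 1 ≤ P ks
P≥1 {ks = ks} pos = >-nonZero⁻¹ (P ks) {{P-nonZero pos}}

-- 1/(k+1) + W/P = (P + (k+1) W) / ((k+1) P) as unnormalised fractions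
-- (mkℚᵘ a d stands for a / (d + 1)).
inverse-add : ∀ k w p → 1 ≤ p →
  mkℚᵘ (ℤ.+ 1) k ℚᵘ.+ mkℚᵘ (ℤ.+ w) (p ∸ 1) ℚᵘ.≃ mkℚᵘ (ℤ.+ (p + suc k * w)) (suc k * p ∸ 1)
inverse-add k w (suc p) _ = *≡* (cong (ℤ._* ℤ.+ suc (p + k * suc p)) numerator)
  where
  numerator : ℤ.+ 1 ℤ.* ℤ.+ suc p ℤ.+ ℤ.+ w ℤ.* ℤ.+ suc k ≡ ℤ.+ (suc p + suc k * w)
  numerator = trans (cong₂ ℤ._+_ (ℤP.*-identityˡ (ℤ.+ suc p)) (sym (ℤP.pos-* w (suc k))))
                    (cong (λ x → ℤ.+ (suc p + x)) (*-comm w (suc k)))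

invSum≃W/P : ∀ {n} (ks : Vec ℕ n) (pos : All (1 ≤_) ks) →
  ℚ.toℚᵘ (invSum ks pos) ℚᵘ.≃ mkℚᵘ (ℤ.+ W ks) (P ks ∸ 1)
invSum≃W/P []            []        = ℚᵘP.≃-refl
invSum≃W/P (suc k ∷ ks) (_ ∷ pos) =
  ℚᵘP.≃-trans (toℚᵘ-homo-+ (ℚ.fromℚᵘ (mkℚᵘ (ℤ.+ 1) k)) (invSum ks pos))
    (ℚᵘP.≃-trans (ℚᵘP.+-cong (toℚᵘ-fromℚᵘ (mkℚᵘ (ℤ.+ 1) k)) (invSum≃W/P ks pos))
      (inverse-add k (W ks) (P ks) (P≥1 pos)))

invSum≤1⇔W≤P : ∀ {n} (ks : Vec ℕ n) (pos : All (1 ≤_) ks) → (invSum ks pos ℚ.≤ 1ℚ) ⇔ (W ks ≤ P ks)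
invSum≤1⇔W≤P ks pos = mk⇔ to from
  where
  P≡ : suc (P ks ∸ 1) ≡ P ks
  P≡ = trans (+-comm 1 _) (m∸n+n≡m (P≥1 pos))
  cross : (W ks ≤ P ks) ⇔ (ℤ.+ W ks ℤ.* ℤ.+ 1 ℤ.≤ ℤ.+ 1 ℤ.* ℤ.+ suc (P ks ∸ 1))
  cross = mk⇔
    (λ W≤P → subst₂ ℤ._≤_ (sym (ℤP.*-identityʳ _)) (sym (ℤP.*-identityˡ _)) (ℤ.+≤+ (subst (W ks ≤_) (sym P≡) W≤P)))
    (λ le → subst (W ks ≤_) P≡ (ℤP.drop‿+≤+ (subst₂ ℤ._≤_ (ℤP.*-identityʳ _) (ℤP.*-identityˡ _) le)))
  to : invSum ks pos ℚ.≤ 1ℚ → W ks ≤ P ks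
  to le with ℚᵘP.≤-respˡ-≃ (invSum≃W/P ks pos) (toℚᵘ-mono-≤ le)
  ... | *≤* le′ = Equivalence.from cross le′
  from : W ks ≤ P ks → invSum ks pos ℚ.≤ 1ℚ
  from W≤P = toℚᵘ-cancel-≤ (ℚᵘP.≤-respˡ-≃ (ℚᵘP.≃-sym (invSum≃W/P ks pos)) (*≤* (Equivalence.to cross W≤P)))

proposition6 : (n : ℕ) → 1 ≤ n → (ks : Vec ℕ n) → (pos : All (λ k → 1 ≤ k) ks) →
    (Σ (Orientation ks) (λ o → (v : Vertex ks) →
        OutdegreeIs o v (n ∸ 1) ⊎ OutdegreeIs o v n))
    ⇔ (invSum ks pos ℚ.≤ 1ℚ)
proposition6 (suc m) _ ks pos = mk⇔
  (λ { (o , outdeg∈) → Equivalence.from (invSum≤1⇔W≤P ks pos)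
                          (necessity m ks pos o (λ v → outdeg-lower o v (outdeg∈ v))) })
  (λ invSum≤1 → sufficiency (suc m) ks pos (Equivalence.to (invSum≤1⇔W≤P ks pos) invSum≤1))
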